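{- For all unit types $U,U'$ and scalars $\alpha,\beta\in\mathcal{S}$: if $\alpha.U\equiv\beta.U'$ then $\alpha=\beta$, and if moreover $\alpha\neq0$ then $U\equiv U'$.
   Context: Scalars form a commutative ring $(\mathcal{S},+,\times)$. Types $T::=U\mid\forall X.T\mid\alpha.T\mid\overline{0}$; unit types $U::=X\mid U\to T\mid\forall X.U$. $\equiv$ is the least congruence on types with $\alpha.\overline{0}\equiv\overline{0}$, $0.T\equiv\overline{0}$, $1.T\equiv T$, $\alpha.(\beta.T)\equiv(\alpha\times\beta).T$, $\forall X.\alpha.T\equiv\alpha.\forall X.T$. -}

module Defs where

open import Level using (Level; _⊔_)
open import Data.Nat using (ℕ)
open import Algebra.Bundles using (CommutativeRing)

module Types {c ℓ : Level} (S : CommutativeRing c ℓ) where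
  open CommutativeRing S renaming (Carrier to Sc)

  mutual
    data UTy : Set c where
      var  : ℕ → UTy
      _⇒_  : UTy → Ty → UTy
      ∀ᵤ   : ℕ → UTy → UTy

    data Ty : Set c where
      unit  : UTy → Ty
      ∀ₜ    : ℕ → Ty → Ty
      _·_   : Sc → Ty → Ty
      𝟘     : Ty

  mutual
    data _≡ᵤ_ : UTy → UTy → Set (c ⊔ ℓ) where
      reflᵤ  : ∀ {U} → U ≡ᵤ U
      symᵤ   : ∀ {U V} → U ≡ᵤ V → V ≡ᵤ U
      transᵤ : ∀ {U V W} → U ≡ᵤ V → V ≡ᵤ W → U ≡ᵤ W
      ⇒-cong : ∀ {U U' T T'} → U ≡ᵤ U' → T ≡ₜ T' → (U ⇒ T) ≡ᵤ (U' ⇒ T')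
      ∀ᵤ-cong : ∀ {X U U'} → U ≡ᵤ U' → ∀ᵤ X U ≡ᵤ ∀ᵤ X U'

    data _≡ₜ_ : Ty → Ty → Set (c ⊔ ℓ) where
      reflₜ  : ∀ {T} → T ≡ₜ T
      symₜ   : ∀ {T T'} → T ≡ₜ T' → T' ≡ₜ T
      transₜ : ∀ {T T' T''} → T ≡ₜ T' → T' ≡ₜ T'' → T ≡ₜ T''
      unit-cong : ∀ {U U'} → U ≡ᵤ U' → unit U ≡ₜ unit U'
      ∀ₜ-cong : ∀ {X T T'} → T ≡ₜ T' → ∀ₜ X T ≡ₜ ∀ₜ X T'
      ·-cong  : ∀ {α β T T'} → α ≈ β → T ≡ₜ T' → (α · T) ≡ₜ (β · T')
      ax-α0   : ∀ {α} → (α · 𝟘) ≡ₜ 𝟘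
      ax-0T   : ∀ {T} → (0# · T) ≡ₜ 𝟘
      ax-1T   : ∀ {T} → (1# · T) ≡ₜ T
      ax-αβ   : ∀ {α β T} → (α · (β · T)) ≡ₜ ((α * β) · T)
      ax-∀α   : ∀ {X α T} → ∀ₜ X (α · T) ≡ₜ (α · ∀ₜ X T)
      -- the grammar's two readings of ∀X.U (as unit type and as type) coincide
      ax-∀U   : ∀ {X U} → unit (∀ᵤ X U) ≡ₜ ∀ₜ X (unit U)

-- Every type T is equivalent to weight T . shape T for a scalar weight and a unit
-- type shape (∀ commutes with scalars, scalars multiply, unit types have weight 1).
-- Equivalent types therefore have equal weights, and equal shapes whenever the
-- weight is non-zero: this relation is an equivalence that every generating axiom
-- and congruence rule of ≡ preserves.
module Submission where

open import Defs
open import Level using (Level; _⊔_)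
open import Data.Product using (_×_; _,_)
open import Relation.Nullary using (¬_; contradiction; contraposition)
open import Algebra.Bundles using (CommutativeRing)

module NormalForm {c ℓ : Level} (S : CommutativeRing c ℓ) where
  open CommutativeRing S renaming (Carrier to Sc)
  open Types S

  weight : Ty → Sc
  weight (unit U) = 1#
  weight (∀ₜ X T) = weight T
  weight (α · T)  = α * weight T
  weight 𝟘        = 0#

  -- The shape of 𝟘 is arbitrary: it is never compared, its weight being 0.
  shape : Ty → UTy
  shape (unit U) = U
  shape (∀ₜ X T) = ∀ᵤ X (shape T)
  shape (α · T)  = shape T
  shape 𝟘        = var 0

  record _∼_ (T T' : Ty) : Set (c ⊔ ℓ) where
    constructor _,_
    field
      weight-≈ : weight T ≈ weight T'
      shape-≡ᵤ : weight T ≉ 0# → shape T ≡ᵤ shape T'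

  ∼-refl : ∀ {T} → T ∼ T
  ∼-refl = refl , λ _ → reflᵤ

  ∼-sym : ∀ {T T'} → T ∼ T' → T' ∼ T
  ∼-sym (w≈w' , shape≡) =
    sym w≈w' , λ w'≉0 → symᵤ (shape≡ (λ w≈0 → w'≉0 (trans (sym w≈w') w≈0)))

  ∼-trans : ∀ {T T' T''} → T ∼ T' → T' ∼ T'' → T ∼ T''
  ∼-trans (w≈w' , shape≡) (w'≈w'' , shape≡') =
    trans w≈w' w'≈w'' ,
    λ w≉0 → transᵤ (shape≡ w≉0) (shape≡' (λ w'≈0 → w≉0 (trans w≈w' w'≈0)))

  *-≉0⇒≉0ʳ : ∀ α β → α * β ≉ 0# → β ≉ 0#
  *-≉0⇒≉0ʳ α β = contraposition (λ β≈0 → trans (*-congˡ β≈0) (zeroʳ α))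

  ≡ₜ⇒∼ : ∀ {T T'} → T ≡ₜ T' → T ∼ T'
  ≡ₜ⇒∼ reflₜ          = ∼-refl
  ≡ₜ⇒∼ (symₜ p)       = ∼-sym (≡ₜ⇒∼ p)
  ≡ₜ⇒∼ (transₜ p q)   = ∼-trans (≡ₜ⇒∼ p) (≡ₜ⇒∼ q)
  ≡ₜ⇒∼ (unit-cong p)  = refl , λ _ → p
  ≡ₜ⇒∼ (∀ₜ-cong p)    = weight-≈ , λ w≉0 → ∀ᵤ-cong (shape-≡ᵤ w≉0)
    where open _∼_ (≡ₜ⇒∼ p)
  ≡ₜ⇒∼ (·-cong {α} {T = T} α≈β p) =
    *-cong α≈β weight-≈ , λ αw≉0 → shape-≡ᵤ (*-≉0⇒≉0ʳ α (weight T) αw≉0)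
    where open _∼_ (≡ₜ⇒∼ p)
  ≡ₜ⇒∼ (ax-α0 {α})    = zeroʳ α , λ _ → reflᵤ
  ≡ₜ⇒∼ (ax-0T {T})    = zeroˡ (weight T) , λ 0w≉0 → contradiction (zeroˡ (weight T)) 0w≉0
  ≡ₜ⇒∼ (ax-1T {T})    = *-identityˡ (weight T) , λ _ → reflᵤ
  ≡ₜ⇒∼ (ax-αβ {α} {β} {T}) = sym (*-assoc α β (weight T)) , λ _ → reflᵤ
  ≡ₜ⇒∼ ax-∀α          = refl , λ _ → reflᵤ
  ≡ₜ⇒∼ ax-∀U          = refl , λ _ → reflᵤ

mainTheorem8 : ∀ {c ℓ} (S : CommutativeRing c ℓ) →
    let open CommutativeRing S
        open Types S
    in ∀ (U U' : UTy) (α β : Carrier) →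
       (α · unit U) ≡ₜ (β · unit U') →
       (α ≈ β) × (¬ (α ≈ 0#) → U ≡ᵤ U')
mainTheorem8 S U U' α β p =
  α≈β , λ α≉0 → shape-≡ᵤ (λ α1≈0 → α≉0 (trans (sym α1≈α) α1≈0))
  where
    open CommutativeRing S
    open NormalForm S
    open _∼_ (≡ₜ⇒∼ p)
    α1≈α : α * 1# ≈ α
    α1≈α = *-identityʳ α
    α≈β : α ≈ β
    α≈β = trans (sym α1≈α) (trans weight-≈ (*-identityʳ β))
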